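{- Let $\theta>0$ and $n\ge1$. Under the Ewens-like distribution for records with parameter $\theta$ on $\mathfrak{S}_n$, for every $k\in[n]$, $$\mathbb{P}_n(\sigma(1)=k)=\frac{(n-1)!\,\theta^{(n-k)}\,\theta}{(n-k)!\,\theta^{(n)}}.$$
   Context: $\mathfrak{S}_n$ is the set of permutations of $[n]=\{1,\dots,n\}$. A permutation $\sigma$ has a record at position $i$ if $\sigma(i)>\sigma(j)$ for all $j<i$; $\mathrm{rec}(\sigma)$ is the number of records. The Ewens-like distribution for records with parameter $\theta>0$ gives each $\sigma\in\mathfrak{S}_n$ probability proportional to $\theta^{\mathrm{rec}(\sigma)}$; $\mathbb{P}_n$ denotes probability under it. The rising factorial is $x^{(m)}=x(x+1)\cdots(x+m-1)$, $x^{(0)}=1$. -}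

module Defs where

open import Level using (Level)
open import Data.Nat using (ℕ; zero; suc; _<ᵇ_)
open import Data.Bool using (Bool; true; false; _∧_; _∨_; not)
open import Data.Fin using (Fin; toℕ; _≟_)
open import Data.Vec using (Vec; []; _∷_; lookup)
open import Data.List using (List; [_]; map; concatMap; filterᵇ; length; allFin; foldr)
open import Relation.Nullary.Decidable using (⌊_⌋)
open import Algebra.Bundles using (CommutativeSemiring)

words : (m n : ℕ) → List (Vec (Fin m) n)
words m zero = [ [] ]
words m (suc n) = concatMap (λ v → map (λ x → x ∷ v) (allFin m)) (words m n)

occurs : ∀ {m n} → Fin m → Vec (Fin m) n → Bool
occurs x [] = false
occurs x (y ∷ ys) = ⌊ x ≟ y ⌋ ∨ occurs x ys

distinct : ∀ {m n} → Vec (Fin m) n → Bool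
distinct [] = true
distinct (x ∷ xs) = not (occurs x xs) ∧ distinct xs

-- 𝔖_n: all permutations of [n] (encoded 0-based as Fin n) in one-line
-- notation σ = (σ(1),…,σ(n)), i.e. the injective maps Fin n → Fin n, each listed exactly once.
perms : (n : ℕ) → List (Vec (Fin n) n)
perms n = filterᵇ distinct (words n n)

allB : ∀ {a} {A : Set a} → (A → Bool) → List A → Bool
allB p = foldr (λ x b → p x ∧ b) true

isRecord : ∀ {n} → Vec (Fin n) n → Fin n → Bool
isRecord {n} σ i = allB (λ j → not (toℕ j <ᵇ toℕ i) ∨ (toℕ (lookup σ j) <ᵇ toℕ (lookup σ i))) (allFin n)

rec : ∀ {n} → Vec (Fin n) n → ℕ
rec {n} σ = length (filterᵇ (isRecord σ) (allFin n))

module _ {c ℓ : Level} (R : CommutativeSemiring c ℓ) where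
  open CommutativeSemiring R

  natR : ℕ → Carrier
  natR zero = 0#
  natR (suc k) = 1# + natR k

  pow : Carrier → ℕ → Carrier
  pow x zero = 1#
  pow x (suc k) = pow x k * x

  rising : Carrier → ℕ → Carrier
  rising x zero = 1#
  rising x (suc k) = rising x k * (x + natR k)

  sumR : ∀ {a} {A : Set a} → (A → Carrier) → List A → Carrier
  sumR f xs = Data.List.foldr (λ a s → f a + s) 0# xs
    where import Data.List

  -- Z_n(θ) = Σ_{σ ∈ 𝔖_n} θ^{rec σ}  (normalising constant of the Ewens-like distribution)
  weightAll : (n : ℕ) → Carrier → Carrier
  weightAll n θ = sumR (λ σ → pow θ (rec σ)) (perms n)

  -- W_{n,k}(θ) = Σ_{σ ∈ 𝔖_n, σ(1) = k} θ^{rec σ}   (k given 0-based as an element of Fin n)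
  weightFirst : (n : ℕ) → Fin n → Carrier → Carrier
  weightFirst zero () θ
  weightFirst (suc m) k θ =
    sumR (λ σ → pow θ (rec σ)) (filterᵇ (λ σ → ⌊ lookup σ Data.Fin.zero ≟ k ⌋) (perms (suc m)))
    where import Data.Fin

-- Generalise from permutations to words listing a finite set A of l values, and count only
-- records that are at least a threshold t. If a elements of A are at least t, the total weight
-- is Φ a l = θ^(a) l!/a!. Split on the first letter x: if x ≥ t it is a record and the rest is
-- a word on A ∖ {x} with threshold x + 1, contributing θ Φ i (l − 1) where i is the number of
-- elements of A above x, so that i runs over 0, …, a − 1; if x < t the rest keeps the threshold
-- and contributes Φ a (l − 1). The rising-factorial identity
-- θ Σ_{i<a} Φ i (l − 1) + (l − a) Φ a (l − 1) = Φ a l closes the induction. Hence Z_n = θ^(n),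
-- and fixing the record σ(1) = k leaves [n] ∖ {k} with threshold k + 1, whence
-- W_{n,k} = θ Φ (n − k) (n − 1) = θ θ^(n−k) (n − 1)!/(n − k)!.

module Submission where

open import Defs
open import Data.Bool using (Bool; true; false; _∧_; _∨_; not; if_then_else_)
open import Data.Bool.Properties using (∧-assoc; ∧-zeroʳ; ∧-identityʳ)
open import Data.Fin using (Fin; toℕ; _≟_)
import Data.Fin as Fin
open import Data.Fin.Properties using (toℕ-injective; toℕ<n)
open import Data.List using (List; []; _∷_; _++_; map; concatMap; filterᵇ; length; allFin)
open import Data.List.Properties using (map-tabulate; foldr-map)
import Data.Nat as ℕ
open import Data.Nat using (ℕ; zero; suc; _∸_; _!; z≤n; _≤_; _<_; _≤ᵇ_; _<ᵇ_)
open import Data.Nat.Properties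
  using (≤ᵇ-reflects-≤; <ᵇ-reflects-<; _≤?_; <⇒≱; <⇒≢; n<1+n; _<?_; ≤-refl; ≤-trans; <⇒≤; <-≤-trans; ≰⇒>; m<n⇒m<1+n; m≤m+n; +-suc; m+n∸m≡n; n∸n≡0; m∸[m∸n]≡n; m∸n+n≡m; ≤∧≢⇒<; ≤-pred; 0∸n≡0; +-∸-assoc; m≤n⇒m∸n≡0)
  renaming (_≟_ to _≟ℕ_)
open import Data.Nat.Base using (_≡ᵇ_)
import Data.Nat.Properties as ℕₚ
open import Algebra.Bundles using (CommutativeSemiring)
open import Data.Vec using (Vec; []; _∷_; lookup)
open import Function using (_∘_; id)
open import Relation.Binary.PropositionalEquality using (_≡_; refl; sym; trans; cong; cong₂; subst; module ≡-Reasoning)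
open import Relation.Nullary using (yes; no; does; contradiction)
open import Relation.Nullary.Reflects using (Reflects; ofʸ; ofⁿ)
open import Relation.Nullary.Decidable using (⌊_⌋; dec-true; dec-false; isYes≗does)
open import Relation.Nullary.Negation using (¬_)

<ᵇ-true : ∀ {y m} → y < m → (y <ᵇ m) ≡ true
<ᵇ-true {y} {m} y<m = dec-true (y <? m) y<m

≤ᵇ-true : ∀ {s y} → s ≤ y → (s ≤ᵇ y) ≡ true
≤ᵇ-true {s} {y} s≤y = dec-true (s ≤? y) s≤y

≤ᵇ-false : ∀ {s y} → y < s → (s ≤ᵇ y) ≡ false
≤ᵇ-false {s} {y} y<s = dec-false (s ≤? y) (<⇒≱ y<s)

≡ᵇ-refl : ∀ m → (m ≡ᵇ m) ≡ true
≡ᵇ-refl m = dec-true (m ≟ℕ m) refl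

≢⇒≡ᵇ-false : ∀ {m n} → ¬ m ≡ n → (m ≡ᵇ n) ≡ false
≢⇒≡ᵇ-false {m} {n} m≢n = dec-false (m ≟ℕ n) m≢n

≤ᵇ-∧-<ᵇ : ∀ t x y → ((t ≤ᵇ y) ∧ (x <ᵇ y)) ≡ (if t ≤ᵇ x then x <ᵇ y else t ≤ᵇ y)
≤ᵇ-∧-<ᵇ t x y with t ≤ᵇ x | ≤ᵇ-reflects-≤ t x | x <ᵇ y | <ᵇ-reflects-< x y | t ≤ᵇ y | ≤ᵇ-reflects-≤ t y
... | true  | ofʸ t≤x | true  | ofʸ x<y | false | ofⁿ t≰y = contradiction (≤-trans t≤x (<⇒≤ x<y)) t≰y
... | false | ofⁿ t≰x | false | ofⁿ x≮y | true  | ofʸ t≤y = contradiction (<-≤-trans (≰⇒> t≰x) t≤y) x≮y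
... | true  | _ | true  | _ | true  | _ = refl
... | true  | _ | false | _ | b     | _ = ∧-zeroʳ b
... | false | _ | true  | _ | b     | _ = ∧-identityʳ b
... | false | _ | false | _ | false | _ = refl

length-filterᵇ-∷ : ∀ {A : Set} (p : A → Bool) x xs →
  length (filterᵇ p (x ∷ xs)) ≡ (if p x then suc (length (filterᵇ p xs)) else length (filterᵇ p xs))
length-filterᵇ-∷ p x xs with p x
... | true  = refl
... | false = refl

length-filterᵇ-map : ∀ {A B : Set} (p : B → Bool) (f : A → B) xs →
  length (filterᵇ p (map f xs)) ≡ length (filterᵇ (p ∘ f) xs)
length-filterᵇ-map p f [] = refl
length-filterᵇ-map p f (x ∷ xs) with p (f x)
... | true  = cong suc (length-filterᵇ-map p f xs)
... | false = length-filterᵇ-map p f xs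

length-filterᵇ-cong : ∀ {A : Set} {p q : A → Bool} → (∀ x → p x ≡ q x) → ∀ xs →
  length (filterᵇ p xs) ≡ length (filterᵇ q xs)
length-filterᵇ-cong p≗q [] = refl
length-filterᵇ-cong {p = p} p≗q (x ∷ xs) rewrite sym (p≗q x) with p x
... | true  = cong suc (length-filterᵇ-cong p≗q xs)
... | false = length-filterᵇ-cong p≗q xs

allB-true : ∀ {A : Set} {p : A → Bool} → (∀ x → p x ≡ true) → ∀ xs → allB p xs ≡ true
allB-true p≡true [] = refl
allB-true p≡true (x ∷ xs) rewrite p≡true x = allB-true p≡true xs

allFin-suc : ∀ n → allFin (suc n) ≡ Fin.zero ∷ map Fin.suc (allFin n)
allFin-suc n = cong (Fin.zero ∷_) (sym (map-tabulate id Fin.suc))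

allB-allFin-suc : ∀ {n} (p : Fin (suc n) → Bool) →
  allB p (allFin (suc n)) ≡ p Fin.zero ∧ allB (p ∘ Fin.suc) (allFin n)
allB-allFin-suc {n} p =
  cong (p Fin.zero ∧_) (trans (cong (allB p) (sym (map-tabulate id Fin.suc))) (foldr-map _ Fin.suc true (allFin n)))

recordTest : ∀ {m l} → Vec (Fin m) l → Fin l → Fin l → Bool
recordTest v i j = not (toℕ j <ᵇ toℕ i) ∨ (toℕ (lookup v j) <ᵇ toℕ (lookup v i))

isRecordAt : ∀ {m l} → Vec (Fin m) l → Fin l → Bool
isRecordAt {l = l} v i = allB (recordTest v i) (allFin l)

recordsFrom : ∀ {m l} → ℕ → Vec (Fin m) l → ℕ
recordsFrom {l = l} t v = length (filterᵇ (λ i → (t ≤ᵇ toℕ (lookup v i)) ∧ isRecordAt v i) (allFin l))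

rec≡recordsFrom0 : ∀ {n} (σ : Vec (Fin n) n) → rec σ ≡ recordsFrom 0 σ
rec≡recordsFrom0 σ = refl

isRecordAt-zero : ∀ {m l} (x : Fin m) (v : Vec (Fin m) l) → isRecordAt (x ∷ v) Fin.zero ≡ true
isRecordAt-zero {l = l} x v = allB-true {p = recordTest (x ∷ v) Fin.zero} (λ { Fin.zero → refl ; (Fin.suc j) → refl }) (allFin (suc l))

isRecordAt-suc : ∀ {m l} (x : Fin m) (v : Vec (Fin m) l) i →
  isRecordAt (x ∷ v) (Fin.suc i) ≡ (toℕ x <ᵇ toℕ (lookup v i)) ∧ isRecordAt v i
isRecordAt-suc x v i = allB-allFin-suc (recordTest (x ∷ v) (Fin.suc i))

recordsFrom-∷ : ∀ {m l} t (x : Fin m) (v : Vec (Fin m) l) →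
  recordsFrom t (x ∷ v) ≡ (if t ≤ᵇ toℕ x then suc (recordsFrom (suc (toℕ x)) v) else recordsFrom t v)
recordsFrom-∷ {l = l} t x v = begin
  #[ Q ] (allFin (suc l))
    ≡⟨ cong #[ Q ] (allFin-suc l) ⟩
  #[ Q ] (Fin.zero ∷ map Fin.suc (allFin l))
    ≡⟨ length-filterᵇ-∷ Q Fin.zero _ ⟩
  (if Q Fin.zero then suc (#[ Q ] (map Fin.suc (allFin l))) else #[ Q ] (map Fin.suc (allFin l)))
    ≡⟨ cong₂ (λ b n → if b then suc n else n) head-record tail-records ⟩
  (if t ≤ᵇ toℕ x then suc (#[ P (t ≤ᵇ toℕ x) ] (allFin l)) else #[ P (t ≤ᵇ toℕ x) ] (allFin l))
    ≡⟨ select (t ≤ᵇ toℕ x) ⟩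
  (if t ≤ᵇ toℕ x then suc (recordsFrom (suc (toℕ x)) v) else recordsFrom t v) ∎
  where
  open ≡-Reasoning
  #[_] : ∀ {n} → (Fin n → Bool) → List (Fin n) → ℕ
  #[ p ] is = length (filterᵇ p is)
  Q : Fin (suc l) → Bool
  Q i = (t ≤ᵇ toℕ (lookup (x ∷ v) i)) ∧ isRecordAt (x ∷ v) i
  -- the threshold for the tail: x + 1 if x is itself a record, t otherwise
  P : Bool → Fin l → Bool
  P b i = (if b then toℕ x <ᵇ toℕ (lookup v i) else t ≤ᵇ toℕ (lookup v i)) ∧ isRecordAt v i
  head-record : Q Fin.zero ≡ (t ≤ᵇ toℕ x)
  head-record = trans (cong ((t ≤ᵇ toℕ x) ∧_) (isRecordAt-zero x v)) (∧-identityʳ _)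
  tail-records : #[ Q ] (map Fin.suc (allFin l)) ≡ #[ P (t ≤ᵇ toℕ x) ] (allFin l)
  tail-records = trans (length-filterᵇ-map Q Fin.suc (allFin l)) (length-filterᵇ-cong (λ i → begin
    (t ≤ᵇ toℕ (lookup v i)) ∧ isRecordAt (x ∷ v) (Fin.suc i)
      ≡⟨ cong ((t ≤ᵇ toℕ (lookup v i)) ∧_) (isRecordAt-suc x v i) ⟩
    (t ≤ᵇ toℕ (lookup v i)) ∧ ((toℕ x <ᵇ toℕ (lookup v i)) ∧ isRecordAt v i)
      ≡⟨ sym (∧-assoc (t ≤ᵇ toℕ (lookup v i)) _ _) ⟩
    ((t ≤ᵇ toℕ (lookup v i)) ∧ (toℕ x <ᵇ toℕ (lookup v i))) ∧ isRecordAt v i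
      ≡⟨ cong (_∧ isRecordAt v i) (≤ᵇ-∧-<ᵇ t (toℕ x) (toℕ (lookup v i))) ⟩
    P (t ≤ᵇ toℕ x) i ∎) (allFin l))
  select : ∀ b → (if b then suc (#[ P b ] (allFin l)) else #[ P b ] (allFin l))
               ≡ (if b then suc (recordsFrom (suc (toℕ x)) v) else recordsFrom t v)
  select true  = refl
  select false = refl

-- Finite sets of values are Boolean predicates on ℕ.
_∖_ : (ℕ → Bool) → ℕ → ℕ → Bool
(A ∖ x) y = A y ∧ not (y ≡ᵇ x)

allIn : ∀ {m l} → (ℕ → Bool) → Vec (Fin m) l → Bool
allIn A [] = true
allIn A (x ∷ v) = A (toℕ x) ∧ allIn A v

distinctIn : ∀ {m l} → (ℕ → Bool) → Vec (Fin m) l → Bool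
distinctIn A [] = true
distinctIn A (x ∷ v) = A (toℕ x) ∧ distinctIn (A ∖ toℕ x) v

toℕ-≡ᵇ : ∀ {m} (x y : Fin m) → (toℕ y ≡ᵇ toℕ x) ≡ ⌊ x ≟ y ⌋
toℕ-≡ᵇ x y with x ≟ y
... | yes refl = ≡ᵇ-refl (toℕ x)
... | no x≢y   = ≢⇒≡ᵇ-false (x≢y ∘ sym ∘ toℕ-injective)

∧-not-interchange : ∀ a e b o → (a ∧ not e) ∧ (b ∧ not o) ≡ (a ∧ b) ∧ not (e ∨ o)
∧-not-interchange false e     b o = refl
∧-not-interchange true  true  b o = sym (∧-zeroʳ b)
∧-not-interchange true  false b o = refl

allIn-∖ : ∀ {m l} A (x : Fin m) (v : Vec (Fin m) l) → allIn (A ∖ toℕ x) v ≡ allIn A v ∧ not (occurs x v)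
allIn-∖ A x [] = refl
allIn-∖ A x (y ∷ v) rewrite toℕ-≡ᵇ x y | allIn-∖ A x v =
  ∧-not-interchange (A (toℕ y)) ⌊ x ≟ y ⌋ (allIn A v) (occurs x v)

distinctIn≡allIn∧distinct : ∀ {m l} A (v : Vec (Fin m) l) → distinctIn A v ≡ allIn A v ∧ distinct v
distinctIn≡allIn∧distinct A [] = refl
distinctIn≡allIn∧distinct A (x ∷ v)
  rewrite distinctIn≡allIn∧distinct (A ∖ toℕ x) v | allIn-∖ A x v =
  trans (cong (A (toℕ x) ∧_) (∧-assoc (allIn A v) _ _)) (sym (∧-assoc (A (toℕ x)) _ _))

all : ℕ → Bool
all _ = true

allIn-all : ∀ {m l} (v : Vec (Fin m) l) → allIn all v ≡ true
allIn-all [] = refl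
allIn-all (x ∷ v) = allIn-all v

distinct≡distinctIn-all : ∀ {m l} (v : Vec (Fin m) l) → distinct v ≡ distinctIn all v
distinct≡distinctIn-all v rewrite distinctIn≡allIn∧distinct all v | allIn-all v = refl

count : ℕ → (ℕ → Bool) → ℕ
count zero    P = 0
count (suc m) P = if P m then suc (count m P) else count m P

count-≤ᵇ : ∀ m s → count m (s ≤ᵇ_) ≡ m ∸ s
count-≤ᵇ zero s = sym (0∸n≡0 s)
count-≤ᵇ (suc m) s with s ≤ᵇ m | ≤ᵇ-reflects-≤ s m
... | true  | ofʸ s≤m = trans (cong suc (count-≤ᵇ m s)) (sym (+-∸-assoc 1 s≤m))
... | false | ofⁿ s≰m = trans (count-≤ᵇ m s) (trans (m≤n⇒m∸n≡0 (<⇒≤ m<s)) (sym (m≤n⇒m∸n≡0 m<s)))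
  where m<s = ≰⇒> s≰m

count-cong : ∀ m {P Q : ℕ → Bool} → (∀ {y} → y < m → P y ≡ Q y) → count m P ≡ count m Q
count-cong zero    P≗Q = refl
count-cong (suc m) P≗Q rewrite P≗Q (n<1+n m) | count-cong m (P≗Q ∘ m<n⇒m<1+n) = refl

count-split : ∀ m (P Q : ℕ → Bool) →
  count m (λ y → P y ∧ Q y) ℕ.+ count m (λ y → P y ∧ not (Q y)) ≡ count m P
count-split zero    P Q = refl
count-split (suc m) P Q with P m | Q m
... | true  | true  = cong suc (count-split m P Q)
... | true  | false = trans (+-suc _ _) (cong suc (count-split m P Q))
... | false | _     = count-split m P Q

count-∖ : ∀ m A x → x < m → A x ≡ true → suc (count m (A ∖ x)) ≡ count m A
count-∖ (suc m) A x x<1+m Ax with m ≟ℕ x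
... | yes refl rewrite ≡ᵇ-refl m | ∧-zeroʳ (A m) | Ax =
  cong suc (count-cong m (λ {y} y<m →
    trans (cong (λ b → A y ∧ not b) (≢⇒≡ᵇ-false (<⇒≢ y<m))) (∧-identityʳ (A y))))
... | no m≢x rewrite ≢⇒≡ᵇ-false m≢x | ∧-identityʳ (A m) with A m
...   | true  = cong suc (count-∖ m A x (≤∧≢⇒< (≤-pred x<1+m) (m≢x ∘ sym)) Ax)
...   | false = count-∖ m A x (≤∧≢⇒< (≤-pred x<1+m) (m≢x ∘ sym)) Ax

above : ℕ → (ℕ → Bool) → ℕ → ℕ
above m A s = count m (λ y → A y ∧ (s ≤ᵇ y))

above-≤-count : ∀ m A s → above m A s ≤ count m A
above-≤-count m A s = subst (above m A s ≤_) (count-split m A (s ≤ᵇ_)) (m≤m+n _ _)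

above-∖ : ∀ m A x s → x < s → above m (A ∖ x) s ≡ above m A s
above-∖ m A x s x<s = count-cong m (λ {y} _ → same y)
  where
  same : ∀ y → ((A ∖ x) y ∧ (s ≤ᵇ y)) ≡ (A y ∧ (s ≤ᵇ y))
  same y with y ≟ℕ x
  ... | yes refl rewrite ≡ᵇ-refl y | ≤ᵇ-false x<s | ∧-zeroʳ (A y) = refl
  ... | no y≢x rewrite ≢⇒≡ᵇ-false y≢x | ∧-identityʳ (A y) = refl

above-empty : ∀ m A s → m ≤ s → above m A s ≡ 0
above-empty zero    A s m≤s = refl
above-empty (suc m) A s m<s rewrite ≤ᵇ-false m<s | ∧-zeroʳ (A m) = above-empty m A s (<⇒≤ m<s)

module _ {c ℓ} (R : CommutativeSemiring c ℓ) where
  open CommutativeSemiring R renaming (refl to ≈-refl; sym to ≈-sym; trans to ≈-trans)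
  open import Relation.Binary.Reasoning.Setoid setoid
  open import Algebra.Solver.Ring.NaturalCoefficients.Default R

  ∑ : ∀ {A : Set} → (A → Carrier) → List A → Carrier
  ∑ = sumR R

  ∑-cong : ∀ {A : Set} {f g : A → Carrier} → (∀ x → f x ≈ g x) → ∀ xs → ∑ f xs ≈ ∑ g xs
  ∑-cong f≈g []       = ≈-refl
  ∑-cong f≈g (x ∷ xs) = +-cong (f≈g x) (∑-cong f≈g xs)

  ∑-zero : ∀ {A : Set} (xs : List A) → ∑ (λ _ → 0#) xs ≈ 0#
  ∑-zero []       = ≈-refl
  ∑-zero (x ∷ xs) = ≈-trans (+-identityˡ _) (∑-zero xs)

  ∑-+ : ∀ {A : Set} (f g : A → Carrier) xs → ∑ (λ x → f x + g x) xs ≈ ∑ f xs + ∑ g xs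
  ∑-+ f g []       = ≈-sym (+-identityˡ _)
  ∑-+ f g (x ∷ xs) = ≈-trans (+-cong ≈-refl (∑-+ f g xs))
    (solve 4 (λ a b c d → (a :+ b) :+ (c :+ d) := (a :+ c) :+ (b :+ d)) ≈-refl (f x) (g x) (∑ f xs) (∑ g xs))

  ∑-*ʳ : ∀ {A : Set} (f : A → Carrier) k xs → ∑ (λ x → f x * k) xs ≈ ∑ f xs * k
  ∑-*ʳ f k []       = ≈-sym (zeroˡ k)
  ∑-*ʳ f k (x ∷ xs) = ≈-trans (+-cong ≈-refl (∑-*ʳ f k xs)) (≈-sym (distribʳ k (f x) (∑ f xs)))

  ∑-++ : ∀ {A : Set} (f : A → Carrier) xs ys → ∑ f (xs ++ ys) ≈ ∑ f xs + ∑ f ys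
  ∑-++ f []       ys = ≈-sym (+-identityˡ _)
  ∑-++ f (x ∷ xs) ys = ≈-trans (+-cong ≈-refl (∑-++ f xs ys)) (≈-sym (+-assoc _ _ _))

  ∑-map : ∀ {A B : Set} (f : B → Carrier) (g : A → B) xs → ∑ f (map g xs) ≈ ∑ (f ∘ g) xs
  ∑-map f g []       = ≈-refl
  ∑-map f g (x ∷ xs) = +-cong ≈-refl (∑-map f g xs)

  ∑-concatMap : ∀ {A B : Set} (f : B → Carrier) (g : A → List B) xs →
    ∑ f (concatMap g xs) ≈ ∑ (λ x → ∑ f (g x)) xs
  ∑-concatMap f g []       = ≈-refl
  ∑-concatMap f g (x ∷ xs) = ≈-trans (∑-++ f (g x) (concatMap g xs)) (+-cong ≈-refl (∑-concatMap f g xs))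

  ∑-filterᵇ : ∀ {A : Set} (f : A → Carrier) (p : A → Bool) xs →
    ∑ f (filterᵇ p xs) ≈ ∑ (λ x → if p x then f x else 0#) xs
  ∑-filterᵇ f p [] = ≈-refl
  ∑-filterᵇ f p (x ∷ xs) with p x
  ... | true  = +-cong ≈-refl (∑-filterᵇ f p xs)
  ... | false = ≈-trans (∑-filterᵇ f p xs) (≈-sym (+-identityˡ _))

  if-swap : ∀ a b (z : Carrier) → (if a then (if b then z else 0#) else 0#) ≡ (if b then (if a then z else 0#) else 0#)
  if-swap true  true  z = refl
  if-swap true  false z = refl
  if-swap false true  z = refl
  if-swap false false z = refl

  ∑-swap : ∀ {A B : Set} (h : A → B → Carrier) xs ys →
    ∑ (λ x → ∑ (h x) ys) xs ≈ ∑ (λ y → ∑ (λ x → h x y) xs) ys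
  ∑-swap h []       ys = ≈-sym (∑-zero ys)
  ∑-swap h (x ∷ xs) ys =
    ≈-trans (+-cong ≈-refl (∑-swap h xs ys)) (≈-sym (∑-+ (h x) (λ y → ∑ (λ x → h x y) xs) ys))

  ∑-words-suc : ∀ {m l} (f : Vec (Fin m) (suc l) → Carrier) →
    ∑ f (words m (suc l)) ≈ ∑ (λ x → ∑ (λ v → f (x ∷ v)) (words m l)) (allFin m)
  ∑-words-suc {m} {l} f = begin
    ∑ f (concatMap (λ v → map (_∷ v) (allFin m)) (words m l))
      ≈⟨ ∑-concatMap f _ (words m l) ⟩
    ∑ (λ v → ∑ f (map (_∷ v) (allFin m))) (words m l)
      ≈⟨ ∑-cong (λ v → ∑-map f (_∷ v) (allFin m)) (words m l) ⟩
    ∑ (λ v → ∑ (λ x → f (x ∷ v)) (allFin m)) (words m l)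
      ≈⟨ ∑-swap (λ v x → f (x ∷ v)) (words m l) (allFin m) ⟩
    ∑ (λ x → ∑ (λ v → f (x ∷ v)) (words m l)) (allFin m) ∎

  ∑-allFin-suc : ∀ {n} (f : Fin (suc n) → Carrier) → ∑ f (allFin (suc n)) ≈ f Fin.zero + ∑ (f ∘ Fin.suc) (allFin n)
  ∑-allFin-suc {n} f = ≈-trans (reflexive (cong (∑ f) (allFin-suc n))) (+-cong ≈-refl (∑-map f Fin.suc (allFin n)))

  ∑-allFin-delta : ∀ {n} (k : Fin n) (h : Fin n → Carrier) →
    ∑ (λ x → if does (x ≟ k) then h x else 0#) (allFin n) ≈ h k
  ∑-allFin-delta {suc n} Fin.zero h = begin
    ∑ (λ x → if does (x ≟ Fin.zero) then h x else 0#) (allFin (suc n))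
      ≈⟨ ∑-allFin-suc (λ x → if does (x ≟ Fin.zero) then h x else 0#) ⟩
    h Fin.zero + ∑ (λ _ → 0#) (allFin n) ≈⟨ +-cong ≈-refl (∑-zero (allFin n)) ⟩
    h Fin.zero + 0#                      ≈⟨ +-identityʳ _ ⟩
    h Fin.zero                           ∎
  ∑-allFin-delta {suc n} (Fin.suc k) h =
    ≈-trans (∑-allFin-suc (λ x → if does (x ≟ Fin.suc k) then h x else 0#))
      (≈-trans (+-identityˡ _) (∑-allFin-delta k (h ∘ Fin.suc)))

  ∑< : ℕ → (ℕ → Carrier) → Carrier
  ∑< zero    f = 0#
  ∑< (suc m) f = ∑< m f + f m

  ∑<-cong : ∀ m {f g : ℕ → Carrier} → (∀ {y} → y < m → f y ≈ g y) → ∑< m f ≈ ∑< m g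
  ∑<-cong zero    f≈g = ≈-refl
  ∑<-cong (suc m) f≈g = +-cong (∑<-cong m (f≈g ∘ m<n⇒m<1+n)) (f≈g (n<1+n m))

  ∑<-+ : ∀ m (f g : ℕ → Carrier) → ∑< m (λ y → f y + g y) ≈ ∑< m f + ∑< m g
  ∑<-+ zero    f g = ≈-sym (+-identityˡ _)
  ∑<-+ (suc m) f g = ≈-trans (+-cong (∑<-+ m f g) ≈-refl)
    (solve 4 (λ a b c d → (a :+ b) :+ (c :+ d) := (a :+ c) :+ (b :+ d)) ≈-refl (∑< m f) (∑< m g) (f m) (g m))

  ∑<-suc : ∀ m (f : ℕ → Carrier) → ∑< (suc m) f ≈ f 0 + ∑< m (f ∘ suc)
  ∑<-suc zero    f = ≈-trans (+-identityˡ _) (≈-sym (+-identityʳ _))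
  ∑<-suc (suc m) f = ≈-trans (+-cong (∑<-suc m f) ≈-refl) (+-assoc _ _ _)

  ∑-allFin-toℕ : ∀ m (f : ℕ → Carrier) → ∑ (f ∘ toℕ) (allFin m) ≈ ∑< m f
  ∑-allFin-toℕ zero    f = ≈-refl
  ∑-allFin-toℕ (suc m) f =
    ≈-trans (∑-allFin-suc {m} (f ∘ toℕ)) (≈-trans (+-cong ≈-refl (∑-allFin-toℕ m (f ∘ suc))) (≈-sym (∑<-suc m f)))

  ∑<-count : ∀ m (P : ℕ → Bool) k → ∑< m (λ y → if P y then k else 0#) ≈ natR R (count m P) * k
  ∑<-count zero    P k = ≈-sym (zeroˡ k)
  ∑<-count (suc m) P k with P m
  ... | true  = ≈-trans (+-cong (∑<-count m P k) ≈-refl)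
                  (solve 2 (λ n k → n :* k :+ k := (con 1 :+ n) :* k) ≈-refl (natR R (count m P)) k)
  ... | false = ≈-trans (+-identityʳ _) (∑<-count m P k)

  -- Relabelling the elements y ≥ t of A by the number of elements of A above y.
  ∑<-reindex : ∀ m A t (g : ℕ → Carrier) →
    ∑< m (λ y → if A y ∧ (t ≤ᵇ y) then g (above m A (suc y)) else 0#) ≈ ∑< (above m A t) g
  ∑<-reindex zero    A t g = ≈-refl
  ∑<-reindex (suc m) A t g = begin
    ∑< m (term (suc m) g) + term (suc m) g m
      ≈⟨ +-cong (∑<-cong m (reflexive ∘ shift _)) (reflexive top) ⟩
    ∑< m (term m g′) + (if A m ∧ (t ≤ᵇ m) then g 0 else 0#)
      ≈⟨ +-cong (∑<-reindex m A t g′) ≈-refl ⟩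
    ∑< (above m A t) g′ + (if A m ∧ (t ≤ᵇ m) then g 0 else 0#)
      ≈⟨ close (A m) (t ≤ᵇ m) (≤ᵇ-reflects-≤ t m) ⟩
    ∑< (above (suc m) A t) g ∎
    where
    term : ℕ → (ℕ → Carrier) → ℕ → Carrier
    term k f y = if A y ∧ (t ≤ᵇ y) then f (above k A (suc y)) else 0#
    g′ : ℕ → Carrier
    g′ = if A m then g ∘ suc else g
    shift : ∀ y → y < m → term (suc m) g y ≡ term m g′ y
    shift y y<m rewrite <ᵇ-true y<m | ∧-identityʳ (A m) with A m
    ... | true  = refl
    ... | false = refl
    top : term (suc m) g m ≡ (if A m ∧ (t ≤ᵇ m) then g 0 else 0#)
    top = cong (λ z → if A m ∧ (t ≤ᵇ m) then g z else 0#) (above-empty (suc m) A (suc m) ≤-refl)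
    close : ∀ a b → Reflects (t ≤ m) b →
      ∑< (above m A t) (if a then g ∘ suc else g) + (if a ∧ b then g 0 else 0#)
        ≈ ∑< (if a ∧ b then suc (above m A t) else above m A t) g
    close false b       _        = +-identityʳ _
    close true  true    _        = ≈-trans (+-comm _ _) (≈-sym (∑<-suc (above m A t) g))
    close true  false (ofⁿ t≰m) rewrite above-empty m A t (<⇒≤ (≰⇒> t≰m)) = +-identityʳ 0#

  natR-+ : ∀ a b → natR R (a ℕ.+ b) ≈ natR R a + natR R b
  natR-+ zero    b = ≈-sym (+-identityˡ _)
  natR-+ (suc a) b = ≈-trans (+-cong ≈-refl (natR-+ a b)) (≈-sym (+-assoc _ _ _))

  natR-* : ∀ a b → natR R (a ℕ.* b) ≈ natR R a * natR R b
  natR-* zero    b = ≈-sym (zeroˡ _)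
  natR-* (suc a) b = ≈-trans (natR-+ b (a ℕ.* b)) (≈-trans (+-cong ≈-refl (natR-* a b))
    (solve 2 (λ x y → y :+ x :* y := (con 1 :+ x) :* y) ≈-refl (natR R a) (natR R b)))

  rising-suc : ∀ x k → rising R x (suc k) ≈ x * rising R (1# + x) k
  rising-suc x zero    = solve 1 (λ x → con 1 :* (x :+ con 0) := x :* con 1) ≈-refl x
  rising-suc x (suc k) = begin
    rising R x (suc k) * (x + natR R (suc k))       ≈⟨ *-cong (rising-suc x k) ≈-refl ⟩
    x * rising R (1# + x) k * (x + (1# + natR R k)) ≈⟨ solve 3 (λ x r n → x :* r :* (x :+ (con 1 :+ n)) := x :* (r :* ((con 1 :+ x) :+ n))) ≈-refl x (rising R (1# + x) k) (natR R k) ⟩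
    x * rising R (1# + x) (suc k)                   ∎

  rising-pascal : ∀ x k → rising R (1# + x) (suc k) ≈ rising R x (suc k) + natR R (suc k) * rising R (1# + x) k
  rising-pascal x k = begin
    rising R (1# + x) k * ((1# + x) + natR R k)
      ≈⟨ solve 3 (λ x r n → r :* ((con 1 :+ x) :+ n) := x :* r :+ (con 1 :+ n) :* r) ≈-refl x (rising R (1# + x) k) (natR R k) ⟩
    x * rising R (1# + x) k + natR R (suc k) * rising R (1# + x) k
      ≈⟨ +-cong (≈-sym (rising-suc x k)) ≈-refl ⟩
    rising R x (suc k) + natR R (suc k) * rising R (1# + x) k ∎

  natR-!-rising : ∀ a b → natR R (a !) * rising R (natR R (suc a)) b ≈ natR R ((a ℕ.+ b) !)
  natR-!-rising a zero = ≈-trans (*-identityʳ _) (reflexive (cong (λ n → natR R (n !)) (sym (ℕₚ.+-identityʳ a))))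
  natR-!-rising a (suc b) = begin
    natR R (a !) * (rising R (natR R (suc a)) b * (natR R (suc a) + natR R b))
      ≈⟨ ≈-sym (*-assoc _ _ _) ⟩
    natR R (a !) * rising R (natR R (suc a)) b * (natR R (suc a) + natR R b)
      ≈⟨ *-cong (natR-!-rising a b) (≈-sym (natR-+ (suc a) b)) ⟩
    natR R ((a ℕ.+ b) !) * natR R (suc (a ℕ.+ b))
      ≈⟨ ≈-trans (*-comm _ _) (≈-sym (natR-* (suc (a ℕ.+ b)) ((a ℕ.+ b) !))) ⟩
    natR R (suc (a ℕ.+ b) !)
      ≡⟨ cong (λ n → natR R (n !)) (sym (+-suc a b)) ⟩
    natR R ((a ℕ.+ suc b) !) ∎

  module _ (θ : Carrier) where

    -- Φ a l = θ^(a) l! / a!  (for a ≤ l)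
    Φ : ℕ → ℕ → Carrier
    Φ a l = rising R θ a * rising R (natR R (suc a)) (l ∸ a)

    ∑<-Φ : ∀ l a → a ≤ suc l → ∑< a (λ i → Φ i l * θ) ≈ rising R θ a * rising R (natR R a) (suc l ∸ a)
    ∑<-Φ l zero    _ = ≈-sym (≈-trans (*-identityˡ _) (≈-trans (rising-suc 0# l) (zeroˡ _)))
    ∑<-Φ l (suc a) a<1+l = begin
      ∑< a (λ i → Φ i l * θ) + Φ a l * θ
        ≈⟨ +-cong (∑<-Φ l a (<⇒≤ a<1+l)) ≈-refl ⟩
      ρ * rising R x (suc l ∸ a) + ρ * rising R (1# + x) (l ∸ a) * θ
        ≡⟨ cong (λ k → ρ * rising R x k + ρ * rising R (1# + x) (l ∸ a) * θ) (+-∸-assoc 1 (≤-pred a<1+l)) ⟩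
      ρ * rising R x (suc (l ∸ a)) + ρ * rising R (1# + x) (l ∸ a) * θ
        ≈⟨ +-cong (*-cong ≈-refl (rising-suc x (l ∸ a))) ≈-refl ⟩
      ρ * (x * rising R (1# + x) (l ∸ a)) + ρ * rising R (1# + x) (l ∸ a) * θ
        ≈⟨ solve 4 (λ ρ x q θ → ρ :* (x :* q) :+ ρ :* q :* θ := ρ :* (θ :+ x) :* q) ≈-refl ρ x (rising R (1# + x) (l ∸ a)) θ ⟩
      rising R θ (suc a) * rising R (natR R (suc a)) (suc l ∸ suc a) ∎
      where
      ρ = rising R θ a
      x = natR R a

    Φ-recurrence : ∀ l a b → a ℕ.+ b ≡ suc l → ∑< a (λ i → Φ i l * θ) + natR R b * Φ a l ≈ Φ a (suc l)
    Φ-recurrence l a zero a+0≡1+l rewrite trans (sym (ℕₚ.+-identityʳ a)) a+0≡1+l = begin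
      ∑< (suc l) (λ i → Φ i l * θ) + 0# * Φ (suc l) l     ≈⟨ +-cong (∑<-Φ l (suc l) ≤-refl) (zeroˡ _) ⟩
      ρ * rising R (natR R (suc l)) (l ∸ l) + 0#          ≡⟨ cong (λ k → ρ * rising R (natR R (suc l)) k + 0#) (n∸n≡0 l) ⟩
      ρ * 1# + 0#                                         ≈⟨ +-identityʳ _ ⟩
      ρ * 1#                                              ≡⟨ cong (λ k → ρ * rising R (natR R (suc (suc l))) k) (sym (n∸n≡0 l)) ⟩
      Φ (suc l) (suc l)                                   ∎
      where ρ = rising R θ (suc l)
    Φ-recurrence l a (suc c) a+1+c≡1+l = begin
      ∑< a (λ i → Φ i l * θ) + natR R (suc c) * Φ a l
        ≈⟨ +-cong (∑<-Φ l a (subst (a ≤_) a+1+c≡1+l (m≤m+n a (suc c)))) ≈-refl ⟩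
      ρ * rising R x (suc l ∸ a) + natR R (suc c) * (ρ * rising R (1# + x) (l ∸ a))
        ≡⟨ cong₂ (λ p q → ρ * rising R x p + natR R (suc c) * (ρ * rising R (1# + x) q)) 1+l∸a≡1+c l∸a≡c ⟩
      ρ * rising R x (suc c) + natR R (suc c) * (ρ * rising R (1# + x) c)
        ≈⟨ solve 4 (λ ρ r n q → ρ :* r :+ n :* (ρ :* q) := ρ :* (r :+ n :* q)) ≈-refl ρ (rising R x (suc c)) (natR R (suc c)) (rising R (1# + x) c) ⟩
      ρ * (rising R x (suc c) + natR R (suc c) * rising R (1# + x) c)
        ≈⟨ *-cong ≈-refl (≈-sym (rising-pascal x c)) ⟩
      ρ * rising R (1# + x) (suc c)
        ≡⟨ cong (λ k → ρ * rising R (1# + x) k) (sym 1+l∸a≡1+c) ⟩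
      Φ a (suc l) ∎
      where
      ρ = rising R θ a
      x = natR R a
      1+l∸a≡1+c : suc l ∸ a ≡ suc c
      1+l∸a≡1+c = trans (cong (_∸ a) (sym a+1+c≡1+l)) (m+n∸m≡n a (suc c))
      l∸a≡c : l ∸ a ≡ c
      l∸a≡c = trans (cong (_∸ a) (sym (ℕₚ.suc-injective (trans (sym (+-suc a c)) a+1+c≡1+l)))) (m+n∸m≡n a c)

    weight : ∀ {m l} → (ℕ → Bool) → ℕ → Vec (Fin m) l → Carrier
    weight A t v = if distinctIn A v then pow R θ (recordsFrom t v) else 0#

    arrangementSum : ℕ → (ℕ → Bool) → ℕ → ℕ → Carrier
    arrangementSum m A t l = ∑ (weight {m} A t) (words m l)

    weight-all : ∀ {n} (σ : Vec (Fin n) n) → (if distinct σ then pow R θ (rec σ) else 0#) ≡ weight all 0 σ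
    weight-all σ = cong₂ (λ b r → if b then pow R θ r else 0#) (distinct≡distinctIn-all σ) (rec≡recordsFrom0 σ)

    weight-∷-∉ : ∀ {m l} A t (x : Fin m) (v : Vec (Fin m) l) → A (toℕ x) ≡ false → weight A t (x ∷ v) ≡ 0#
    weight-∷-∉ A t x v Ax rewrite Ax = refl

    weight-∷-record : ∀ {m l} A t (x : Fin m) (v : Vec (Fin m) l) → A (toℕ x) ≡ true → t ≤ toℕ x →
      weight A t (x ∷ v) ≈ weight (A ∖ toℕ x) (suc (toℕ x)) v * θ
    weight-∷-record A t x v Ax t≤x rewrite Ax | recordsFrom-∷ t x v | ≤ᵇ-true t≤x
      with distinctIn (A ∖ toℕ x) v
    ... | true  = ≈-refl
    ... | false = ≈-sym (zeroˡ θ)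

    weight-∷-nonrecord : ∀ {m l} A t (x : Fin m) (v : Vec (Fin m) l) → A (toℕ x) ≡ true → toℕ x < t →
      weight A t (x ∷ v) ≡ weight (A ∖ toℕ x) t v
    weight-∷-nonrecord A t x v Ax x<t rewrite Ax | recordsFrom-∷ t x v | ≤ᵇ-false x<t = refl

    ClosedForm : ℕ → ℕ → Set ℓ
    ClosedForm m l = ∀ A t → count m A ≡ l → arrangementSum m A t l ≈ Φ (above m A t) l

    firstLetterSum : ℕ → ℕ → (ℕ → Bool) → ℕ → ℕ → Carrier
    firstLetterSum m l A t y =
      if A y then (if t ≤ᵇ y then Φ (above m A (suc y)) l * θ else Φ (above m A t) l) else 0#

    ∑-weight-∷ : ∀ {m l} A t → ClosedForm m l → count m A ≡ suc l → ∀ (x : Fin m) →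
      ∑ (λ v → weight A t (x ∷ v)) (words m l) ≈ firstLetterSum m l A t (toℕ x)
    ∑-weight-∷ {m} {l} A t closed #A≡1+l x = by-cases (A (toℕ x)) (t ≤ᵇ toℕ x) refl (≤ᵇ-reflects-≤ t (toℕ x))
      where
      #A∖x≡l : A (toℕ x) ≡ true → count m (A ∖ toℕ x) ≡ l
      #A∖x≡l Ax = ℕₚ.suc-injective (trans (count-∖ m A (toℕ x) (toℕ<n x) Ax) #A≡1+l)
      -- The split is by arguments rather than by with, which would unfold weight in the goal.
      by-cases : ∀ α β → A (toℕ x) ≡ α → Reflects (t ≤ toℕ x) β →
        ∑ (λ v → weight A t (x ∷ v)) (words m l)
          ≈ (if α then (if β then Φ (above m A (suc (toℕ x))) l * θ else Φ (above m A t) l) else 0#)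
      by-cases false _ Ax _ =
        ≈-trans (∑-cong (λ v → reflexive (weight-∷-∉ A t x v Ax)) (words m l)) (∑-zero (words m l))
      by-cases true true Ax (ofʸ t≤x) = begin
        ∑ (λ v → weight A t (x ∷ v)) (words m l)
          ≈⟨ ∑-cong (λ v → weight-∷-record A t x v Ax t≤x) (words m l) ⟩
        ∑ (λ v → weight (A ∖ toℕ x) (suc (toℕ x)) v * θ) (words m l)
          ≈⟨ ∑-*ʳ _ θ (words m l) ⟩
        arrangementSum m (A ∖ toℕ x) (suc (toℕ x)) l * θ
          ≈⟨ *-cong (closed (A ∖ toℕ x) (suc (toℕ x)) (#A∖x≡l Ax)) ≈-refl ⟩
        Φ (above m (A ∖ toℕ x) (suc (toℕ x))) l * θ
          ≡⟨ cong (λ a → Φ a l * θ) (above-∖ m A (toℕ x) (suc (toℕ x)) (n<1+n _)) ⟩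
        Φ (above m A (suc (toℕ x))) l * θ ∎
      by-cases true false Ax (ofⁿ t≰x) = begin
        ∑ (λ v → weight A t (x ∷ v)) (words m l)
          ≈⟨ ∑-cong (λ v → reflexive (weight-∷-nonrecord A t x v Ax (≰⇒> t≰x))) (words m l) ⟩
        arrangementSum m (A ∖ toℕ x) t l
          ≈⟨ closed (A ∖ toℕ x) t (#A∖x≡l Ax) ⟩
        Φ (above m (A ∖ toℕ x) t) l
          ≡⟨ cong (λ a → Φ a l) (above-∖ m A (toℕ x) t (≰⇒> t≰x)) ⟩
        Φ (above m A t) l ∎

    ∑<-firstLetterSum : ∀ m l A t →
      ∑< m (firstLetterSum m l A t)
        ≈ ∑< (above m A t) (λ i → Φ i l * θ) + natR R (count m (λ y → A y ∧ not (t ≤ᵇ y))) * Φ (above m A t) l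
    ∑<-firstLetterSum m l A t = begin
      ∑< m (firstLetterSum m l A t)
        ≈⟨ ≈-trans (∑<-cong m (λ {y} _ → split y)) (∑<-+ m _ _) ⟩
      ∑< m (λ y → if A y ∧ (t ≤ᵇ y) then Φ (above m A (suc y)) l * θ else 0#)
        + ∑< m (λ y → if A y ∧ not (t ≤ᵇ y) then Φ (above m A t) l else 0#)
        ≈⟨ +-cong (∑<-reindex m A t (λ i → Φ i l * θ)) (∑<-count m _ (Φ (above m A t) l)) ⟩
      ∑< (above m A t) (λ i → Φ i l * θ) + natR R (count m (λ y → A y ∧ not (t ≤ᵇ y))) * Φ (above m A t) l ∎
      where
      split : ∀ y → firstLetterSum m l A t y
        ≈ (if A y ∧ (t ≤ᵇ y) then Φ (above m A (suc y)) l * θ else 0#)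
          + (if A y ∧ not (t ≤ᵇ y) then Φ (above m A t) l else 0#)
      split y with A y | t ≤ᵇ y
      ... | true  | true  = ≈-sym (+-identityʳ _)
      ... | true  | false = ≈-sym (+-identityˡ _)
      ... | false | _     = ≈-sym (+-identityˡ _)

    closedForm-suc : ∀ {m l} → ClosedForm m l → ClosedForm m (suc l)
    closedForm-suc {m} {l} closed A t #A≡1+l = begin
      ∑ (weight A t) (words m (suc l))
        ≈⟨ ∑-words-suc {m} {l} (weight A t) ⟩
      ∑ (λ x → ∑ (λ v → weight A t (x ∷ v)) (words m l)) (allFin m)
        ≈⟨ ∑-cong (∑-weight-∷ A t closed #A≡1+l) (allFin m) ⟩
      ∑ (firstLetterSum m l A t ∘ toℕ) (allFin m)
        ≈⟨ ∑-allFin-toℕ m (firstLetterSum m l A t) ⟩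
      ∑< m (firstLetterSum m l A t)
        ≈⟨ ∑<-firstLetterSum m l A t ⟩
      ∑< a (λ i → Φ i l * θ) + natR R b * Φ a l
        ≈⟨ Φ-recurrence l a b (trans (count-split m A (t ≤ᵇ_)) #A≡1+l) ⟩
      Φ a (suc l) ∎
      where
      a = above m A t
      b = count m (λ y → A y ∧ not (t ≤ᵇ y))

    closedForm : ∀ m l → ClosedForm m l
    closedForm m zero A t #A≡0 = begin
      1# + 0#           ≈⟨ ≈-trans (+-identityʳ 1#) (≈-sym (*-identityʳ 1#)) ⟩
      Φ 0 0             ≡⟨ cong (λ a → Φ a 0) (sym (ℕₚ.n≤0⇒n≡0 (subst (above m A t ≤_) #A≡0 (above-≤-count m A t)))) ⟩
      Φ (above m A t) 0 ∎
    closedForm m (suc l) = closedForm-suc (closedForm m l)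

    weightAll≈rising : ∀ n → weightAll R n θ ≈ rising R θ n
    weightAll≈rising n = begin
      ∑ (λ σ → pow R θ (rec σ)) (filterᵇ distinct (words n n))
        ≈⟨ ∑-filterᵇ _ distinct (words n n) ⟩
      ∑ (λ σ → if distinct σ then pow R θ (rec σ) else 0#) (words n n)
        ≈⟨ ∑-cong (reflexive ∘ weight-all) (words n n) ⟩
      arrangementSum n all 0 n
        ≈⟨ closedForm n n all 0 (count-≤ᵇ n 0) ⟩
      Φ (above n all 0) n
        ≡⟨ cong (λ a → Φ a n) (count-≤ᵇ n 0) ⟩
      rising R θ n * rising R (natR R (suc n)) (n ∸ n)
        ≡⟨ cong (λ j → rising R θ n * rising R (natR R (suc n)) j) (n∸n≡0 n) ⟩
      rising R θ n * 1#
        ≈⟨ *-identityʳ _ ⟩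
      rising R θ n ∎

    weightFirst≈arrangementSum : ∀ m (k : Fin (suc m)) →
      weightFirst R (suc m) k θ ≈ arrangementSum (suc m) (all ∖ toℕ k) (suc (toℕ k)) m * θ
    weightFirst≈arrangementSum m k = begin
      ∑ (λ σ → pow R θ (rec σ)) (filterᵇ (λ σ → ⌊ lookup σ Fin.zero ≟ k ⌋) (filterᵇ distinct (words n n)))
        ≈⟨ ∑-filterᵇ _ _ (filterᵇ distinct (words n n)) ⟩
      ∑ (λ σ → if ⌊ lookup σ Fin.zero ≟ k ⌋ then pow R θ (rec σ) else 0#) (filterᵇ distinct (words n n))
        ≈⟨ ∑-filterᵇ _ distinct (words n n) ⟩
      ∑ (λ σ → if distinct σ then (if ⌊ lookup σ Fin.zero ≟ k ⌋ then pow R θ (rec σ) else 0#) else 0#) (words n n)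
        ≈⟨ ∑-cong (reflexive ∘ starts-with-k) (words n n) ⟩
      ∑ (λ σ → if does (lookup σ Fin.zero ≟ k) then weight all 0 σ else 0#) (words n (suc m))
        ≈⟨ ∑-words-suc {n} {m} _ ⟩
      ∑ (λ x → ∑ (λ v → if does (x ≟ k) then weight all 0 (x ∷ v) else 0#) (words n m)) (allFin n)
        ≈⟨ ∑-swap (λ x v → if does (x ≟ k) then weight all 0 (x ∷ v) else 0#) (allFin n) (words n m) ⟩
      ∑ (λ v → ∑ (λ x → if does (x ≟ k) then weight all 0 (x ∷ v) else 0#) (allFin n)) (words n m)
        ≈⟨ ∑-cong (λ v → ∑-allFin-delta k (λ x → weight all 0 (x ∷ v))) (words n m) ⟩
      ∑ (λ v → weight all 0 (k ∷ v)) (words n m)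
        ≈⟨ ∑-cong (λ v → weight-∷-record all 0 k v refl z≤n) (words n m) ⟩
      ∑ (λ v → weight (all ∖ toℕ k) (suc (toℕ k)) v * θ) (words n m)
        ≈⟨ ∑-*ʳ _ θ (words n m) ⟩
      arrangementSum n (all ∖ toℕ k) (suc (toℕ k)) m * θ ∎
      where
      n = suc m
      starts-with-k : ∀ σ →
        (if distinct σ then (if ⌊ lookup σ Fin.zero ≟ k ⌋ then pow R θ (rec σ) else 0#) else 0#)
          ≡ (if does (lookup σ Fin.zero ≟ k) then weight all 0 σ else 0#)
      starts-with-k σ = trans (if-swap (distinct σ) _ (pow R θ (rec σ)))
        (cong₂ (λ d w → if d then w else 0#) (isYes≗does (lookup σ Fin.zero ≟ k)) (weight-all σ))

    weightFirst≈rising : ∀ m (k : Fin (suc m)) →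
      weightFirst R (suc m) k θ ≈ rising R θ (m ∸ toℕ k) * rising R (natR R (suc (m ∸ toℕ k))) (toℕ k) * θ
    weightFirst≈rising m k = begin
      weightFirst R (suc m) k θ
        ≈⟨ weightFirst≈arrangementSum m k ⟩
      arrangementSum (suc m) (all ∖ toℕ k) (suc (toℕ k)) m * θ
        ≈⟨ *-cong (closedForm (suc m) m (all ∖ toℕ k) (suc (toℕ k)) #all∖k≡m) ≈-refl ⟩
      Φ (above (suc m) (all ∖ toℕ k) (suc (toℕ k))) m * θ
        ≡⟨ cong (λ a → Φ a m * θ) above≡m∸k ⟩
      rising R θ (m ∸ toℕ k) * rising R (natR R (suc (m ∸ toℕ k))) (m ∸ (m ∸ toℕ k)) * θ
        ≡⟨ cong (λ j → rising R θ (m ∸ toℕ k) * rising R (natR R (suc (m ∸ toℕ k))) j * θ) (m∸[m∸n]≡n (≤-pred (toℕ<n k))) ⟩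
      rising R θ (m ∸ toℕ k) * rising R (natR R (suc (m ∸ toℕ k))) (toℕ k) * θ ∎
      where
      #all∖k≡m : count (suc m) (all ∖ toℕ k) ≡ m
      #all∖k≡m = ℕₚ.suc-injective (trans (count-∖ (suc m) all (toℕ k) (toℕ<n k) refl) (count-≤ᵇ (suc m) 0))
      above≡m∸k : above (suc m) (all ∖ toℕ k) (suc (toℕ k)) ≡ m ∸ toℕ k
      above≡m∸k = trans (above-∖ (suc m) all (toℕ k) (suc (toℕ k)) (n<1+n _)) (count-≤ᵇ (suc m) (suc (toℕ k)))

theorem3 : ∀ {c ℓ} (R : CommutativeSemiring c ℓ) (θ : CommutativeSemiring.Carrier R) (m : ℕ) (kf : Fin (suc m)) →
    CommutativeSemiring._≈_ R
      (CommutativeSemiring._*_ R (CommutativeSemiring._*_ R (natR R ((m ∸ toℕ kf) !)) (rising R θ (suc m))) (weightFirst R (suc m) kf θ))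
      (CommutativeSemiring._*_ R (CommutativeSemiring._*_ R (CommutativeSemiring._*_ R (natR R (m !)) (rising R θ (m ∸ toℕ kf))) θ) (weightAll R (suc m) θ))
theorem3 R θ m kf = begin
  natR R (a !) * rising R θ (suc m) * weightFirst R (suc m) kf θ
    ≈⟨ *-cong ≈-refl (weightFirst≈rising R θ m kf) ⟩
  natR R (a !) * rising R θ (suc m) * (rising R θ a * rising R (natR R (suc a)) k * θ)
    ≈⟨ solve 5 (λ f r ρ q t → f :* r :* (ρ :* q :* t) := f :* q :* ρ :* t :* r) ≈-refl
         (natR R (a !)) (rising R θ (suc m)) (rising R θ a) (rising R (natR R (suc a)) k) θ ⟩
  natR R (a !) * rising R (natR R (suc a)) k * rising R θ a * θ * rising R θ (suc m)
    ≈⟨ *-cong (*-cong (*-cong (natR-!-rising R a k) ≈-refl) ≈-refl) (≈-sym (weightAll≈rising R θ (suc m))) ⟩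
  natR R ((a ℕ.+ k) !) * rising R θ a * θ * weightAll R (suc m) θ
    ≡⟨ cong (λ j → natR R (j !) * rising R θ a * θ * weightAll R (suc m) θ) (m∸n+n≡m (≤-pred (toℕ<n kf))) ⟩
  natR R (m !) * rising R θ a * θ * weightAll R (suc m) θ ∎
  where
  open CommutativeSemiring R renaming (refl to ≈-refl; sym to ≈-sym)
  open import Relation.Binary.Reasoning.Setoid setoid
  open import Algebra.Solver.Ring.NaturalCoefficients.Default R
  k = toℕ kf
  a = m ∸ k
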